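{- (1) Any union of generic theories is generic. (2) Any union of closed generic theories is closed generic. (3) Every generic theory is closed generic. (4) $\mathbf{V}$ is generic. (5) $\mathbf{K}$ is generic.
   Context: Fix a nonempty set of symbols called propositional atoms and a symbol $\mathrm{K}$ which is not a propositional atom. Formulas are defined recursively: every propositional atom is a formula; if $\varphi,\psi$ are formulas then so are $\neg\varphi$, $(\varphi\wedge\psi)$, $(\varphi\vee\psi)$, $(\varphi\rightarrow\psi)$; if $\varphi$ is a formula then so is $\mathrm{K}(\varphi)$. A formula is basic if it is a propositional atom or of the form $\mathrm{K}\varphi$. A theory is a set of formulas. A model is a function assigning a truth value to every basic formula; truth $\mathscr M\models\varphi$ of an arbitrary formula is defined from the values of basic formulas by the classical truth tables (formulas $\mathrm{K}\varphi$ are treated like atoms). $\mathscr M\models T$ means $\mathscr M\models\varphi$ for all $\varphi\in T$; $T\models\varphi$ means every model of $T$ satisfies $\varphi$; $\varphi$ is valid if $\emptyset\models\varphi$. A theory $T$ is closed if $\varphi\in T$ implies $\mathrm{K}\varphi\in T$. $\mathbf{V}=\{\mathrm{K}\varphi:\varphi\text{ valid}\}$; $\mathbf{K}=\{\mathrm{K}(\varphi\rightarrow\psi)\rightarrow(\mathrm{K}\varphi\rightarrow\mathrm{K}\psi)\}$ (all formulas of this form). For a theory $T$ and a set $S$ of propositional atoms, $\mathscr M_{T,S}$ is the model with $\mathscr M_{T,S}\models p$ iff $p\in S$ for atoms $p$, and $\mathscr M_{T,S}\models\mathrm{K}\varphi$ iff $T\models\varphi$. A theory $T$ is generic if for every set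 $S$ of propositional atoms and every theory $T'\supseteq T$, $\mathscr M_{T',S}\models T$; $T$ is closed generic if for every set $S$ of propositional atoms and every closed theory $T'\supseteq T$, $\mathscr M_{T',S}\models T$. -}

module Defs where

open import Data.Bool using (Bool; true; false; not; _∧_; _∨_)
open import Data.Product using (Σ; ∃; _×_; _,_)
open import Data.Empty using (⊥)
open import Relation.Binary.PropositionalEquality using (_≡_)
open import Function.Bundles using (_⇔_)

data Formula (A : Set) : Set where
  atom : A → Formula A
  ¬'_  : Formula A → Formula A
  _∧'_ : Formula A → Formula A → Formula A
  _∨'_ : Formula A → Formula A → Formula A
  _⇒'_ : Formula A → Formula A → Formula A
  K    : Formula A → Formula A

data Basic (A : Set) : Set where
  batom : A → Basic A
  bK    : Formula A → Basic A

Model : Set → Set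
Model A = Basic A → Bool

_⇒b_ : Bool → Bool → Bool
x ⇒b y = not x ∨ y

eval : {A : Set} → Model A → Formula A → Bool
eval M (atom p) = M (batom p)
eval M (¬' φ)   = not (eval M φ)
eval M (φ ∧' ψ) = eval M φ ∧ eval M ψ
eval M (φ ∨' ψ) = eval M φ ∨ eval M ψ
eval M (φ ⇒' ψ) = eval M φ ⇒b eval M ψ
eval M (K φ)    = M (bK φ)

_⊨_ : {A : Set} → Model A → Formula A → Set
M ⊨ φ = eval M φ ≡ true

Theory : Set → Set₁
Theory A = Formula A → Set

AtomSet : Set → Set₁
AtomSet A = A → Set

_⊨T_ : {A : Set} → Model A → Theory A → Set
M ⊨T T = ∀ φ → T φ → M ⊨ φ

_⊨ₜ_ : {A : Set} → Theory A → Formula A → Set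
T ⊨ₜ φ = ∀ (M : Model _) → M ⊨T T → M ⊨ φ

Valid : {A : Set} → Formula A → Set
Valid φ = ∀ M → M ⊨ φ

_⊆_ : {A : Set} → Theory A → Theory A → Set
T ⊆ T' = ∀ φ → T φ → T' φ

Closed : {A : Set} → Theory A → Set
Closed T = ∀ φ → T φ → T (K φ)

-- "M is the model M_{T,S}": its values on basic formulas are
-- characterised by  M ⊨ p ⇔ p ∈ S  and  M ⊨ K φ ⇔ T ⊨ φ.
-- (Classically there is exactly one such model.)
IsMTS : {A : Set} → Theory A → AtomSet A → Model A → Set
IsMTS T S M =
  (∀ p → (M (batom p) ≡ true) ⇔ S p) × (∀ φ → (M (bK φ) ≡ true) ⇔ (T ⊨ₜ φ))

Generic : {A : Set} → Theory A → Set₁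
Generic {A} T = ∀ (S : AtomSet A) (T' : Theory A) → T ⊆ T' →
  ∀ (M : Model A) → IsMTS T' S M → M ⊨T T

ClosedGeneric : {A : Set} → Theory A → Set₁
ClosedGeneric {A} T = ∀ (S : AtomSet A) (T' : Theory A) → Closed T' → T ⊆ T' →
  ∀ (M : Model A) → IsMTS T' S M → M ⊨T T

⋃ : {A I : Set} → (I → Theory A) → Theory A
⋃ T φ = ∃ λ i → T i φ

𝐕 : {A : Set} → Theory A
𝐕 ψ = Σ _ λ φ → Valid φ × (ψ ≡ K φ)

𝐊 : {A : Set} → Theory A
𝐊 χ = Σ _ λ φ → Σ _ λ ψ → χ ≡ (K (φ ⇒' ψ) ⇒' (K φ ⇒' K ψ))

{-# OPTIONS --safe #-}
module Submission where

-- In M_{T,S} a formula K φ holds iff T ⊨ φ.  Hence K φ holds for valid φ, and the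
-- K axiom holds because semantic consequence is closed under modus ponens.  The
-- remaining parts are bookkeeping: an extension of ⋃ T extends each T i, and closed
-- genericity quantifies over fewer extensions than genericity.

open import Defs
open import Data.Bool using (true; false)
open import Data.Product using (_×_; _,_; proj₂)
open import Relation.Binary.PropositionalEquality using (_≡_; refl)
open import Function.Bundles using (Equivalence)

module _ {A : Set} where

  ⊆-trans : {T₁ T₂ T₃ : Theory A} → T₁ ⊆ T₂ → T₂ ⊆ T₃ → T₁ ⊆ T₃
  ⊆-trans sub₁₂ sub₂₃ φ t = sub₂₃ φ (sub₁₂ φ t)

  ⋃-upper : {I : Set} (T : I → Theory A) (i : I) → T i ⊆ ⋃ T
  ⋃-upper T i φ t = i , t

  ⊨T-⋃ : {I : Set} {T : I → Theory A} {M : Model A} → (∀ i → M ⊨T T i) → M ⊨T ⋃ T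
  ⊨T-⋃ models φ (i , t) = models i φ t

  ⊨-⇒-elim : {M : Model A} {φ ψ : Formula A} → M ⊨ (φ ⇒' ψ) → M ⊨ φ → M ⊨ ψ
  ⊨-⇒-elim {M} {φ} ⊨φ⇒ψ ⊨φ with eval M φ
  ⊨-⇒-elim ⊨φ⇒ψ refl | true = ⊨φ⇒ψ

  ⊨-⇒-intro : {M : Model A} {φ ψ : Formula A} → (M ⊨ φ → M ⊨ ψ) → M ⊨ (φ ⇒' ψ)
  ⊨-⇒-intro {M} {φ} {ψ} f with eval M φ
  ... | false = refl
  ... | true with eval M ψ | f refl
  ...   | true | _ = refl

  ⊨ₜ-mp : {T : Theory A} {φ ψ : Formula A} → T ⊨ₜ (φ ⇒' ψ) → T ⊨ₜ φ → T ⊨ₜ ψ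
  ⊨ₜ-mp {φ = φ} {ψ} T⊨φ⇒ψ T⊨φ M M⊨T = ⊨-⇒-elim {M} {φ} {ψ} (T⊨φ⇒ψ M M⊨T) (T⊨φ M M⊨T)

  valid⇒⊨ₜ : {T : Theory A} {φ : Formula A} → Valid φ → T ⊨ₜ φ
  valid⇒⊨ₜ valid M _ = valid M

  module MTS (T : Theory A) (S : AtomSet A) (M : Model A) (isMTS : IsMTS T S M) where

    ⊨K⇒⊨ₜ : (φ : Formula A) → M ⊨ K φ → T ⊨ₜ φ
    ⊨K⇒⊨ₜ φ = Equivalence.to (proj₂ isMTS φ)

    ⊨ₜ⇒⊨K : (φ : Formula A) → T ⊨ₜ φ → M ⊨ K φ
    ⊨ₜ⇒⊨K φ = Equivalence.from (proj₂ isMTS φ)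

    ⊨-𝐊 : (φ ψ : Formula A) → M ⊨ (K (φ ⇒' ψ) ⇒' (K φ ⇒' K ψ))
    ⊨-𝐊 φ ψ =
      ⊨-⇒-intro {M} {K (φ ⇒' ψ)} {K φ ⇒' K ψ} λ ⊨Kφ⇒ψ →
      ⊨-⇒-intro {M} {K φ} {K ψ} λ ⊨Kφ →
        ⊨ₜ⇒⊨K ψ (⊨ₜ-mp {φ = φ} {ψ} (⊨K⇒⊨ₜ (φ ⇒' ψ) ⊨Kφ⇒ψ) (⊨K⇒⊨ₜ φ ⊨Kφ))

  ⋃-generic : {I : Set} (T : I → Theory A) → (∀ i → Generic (T i)) → Generic (⋃ T)
  ⋃-generic T generic S T' sub M isMTS =
    ⊨T-⋃ λ i → generic i S T' (⊆-trans (⋃-upper T i) sub) M isMTS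

  ⋃-closedGeneric : {I : Set} (T : I → Theory A) →
                    (∀ i → ClosedGeneric (T i)) → ClosedGeneric (⋃ T)
  ⋃-closedGeneric T generic S T' closed sub M isMTS =
    ⊨T-⋃ λ i → generic i S T' closed (⊆-trans (⋃-upper T i) sub) M isMTS

  generic⇒closedGeneric : (T : Theory A) → Generic T → ClosedGeneric T
  generic⇒closedGeneric T generic S T' _ = generic S T'

  𝐕-generic : Generic (𝐕 {A})
  𝐕-generic S T' _ M isMTS _ (φ , valid , refl) =
    MTS.⊨ₜ⇒⊨K T' S M isMTS φ (valid⇒⊨ₜ {φ = φ} valid)

  𝐊-generic : Generic (𝐊 {A})
  𝐊-generic S T' _ M isMTS _ (φ , ψ , refl) = MTS.⊨-𝐊 T' S M isMTS φ ψ

proposition14 : (A : Set) → A →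
    ((I : Set) (T : I → Theory A) → (∀ i → Generic (T i)) → Generic (⋃ T))
    × ((I : Set) (T : I → Theory A) → (∀ i → ClosedGeneric (T i)) → ClosedGeneric (⋃ T))
    × ((T : Theory A) → Generic T → ClosedGeneric T)
    × Generic (𝐕 {A})
    × Generic (𝐊 {A})
proposition14 A _ =
    (λ I → ⋃-generic)
  , (λ I → ⋃-closedGeneric)
  , generic⇒closedGeneric
  , 𝐕-generic
  , 𝐊-generic
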